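{- Let $k$ be a commutative ring that is not the zero ring and let $d_1,\dots,d_t\in\mathbb{Z}^2\setminus\{0\}$ be pairwise linearly independent. Give $L(\mathbb{Z}^2,k)=\bigoplus_{i=1}^t k[\mathbb{Z}^2]/([d_i]-1)$ the product ring structure, so that the line sum map $\sigma:k[\mathbb{Z}^2]\to L(\mathbb{Z}^2,k)$, $f\mapsto(f \bmod ([d_i]-1))_{i=1}^t$, is a $k$-algebra homomorphism. Put $D_i=\prod_{j\ne i}([d_j]-1)\in k[\mathbb{Z}^2]$ and let $\overline{D_i}$ be its image in $k[\mathbb{Z}^2]/([d_i]-1)$. Then the conductor of $L(\mathbb{Z}^2,k)$ over its subring $\operatorname{im}(\sigma)$, i.e. the largest ideal of $L(\mathbb{Z}^2,k)$ that is contained in $\operatorname{im}(\sigma)$ (and hence is also an ideal of $\operatorname{im}(\sigma)$), is $$\mathfrak{f}_k=\overline{D_1}\,\frac{k[\mathbb{Z}^2]}{([d_1]-1)}\oplus\cdots\oplus\overline{D_t}\,\frac{k[\mathbb{Z}^2]}{([d_t]-1)}.$$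
   Context: $k[\mathbb{Z}^2]$ is the group ring (basis $[x]$, $x\in\mathbb{Z}^2$, $[x][y]=[x+y]$), identified with the module of finitely supported tables $\mathbb{Z}^2\to k$. The quotient $k[\mathbb{Z}^2]/([d_i]-1)\cong k[\mathbb{Z}^2/\langle d_i\rangle]$ is identified with the free module on the lattice lines in direction $d_i$, and under these identifications $\sigma$ is the line sum map, sending a point to the tuple of lines through it in the directions $d_i$. -}

module Defs where

open import Level using (Level; _⊔_; suc)
open import Algebra.Bundles using (CommutativeRing)
open import Data.Integer as ℤ using (ℤ)
open import Data.Product using (Σ; _×_; _,_)
open import Data.Product.Properties using (≡-dec)
open import Data.List using (List; []; _∷_; _++_; map; concatMap; foldr; filter)
open import Data.Fin using (Fin)
import Data.Nat
open import Data.Fin.Properties as FinP using ()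
open import Data.List using () renaming ([_] to singleton)
open import Relation.Nullary using (¬_; yes; no; ¬?)
open import Relation.Binary.PropositionalEquality using (_≡_; _≢_)
open import Data.List.Base using () renaming (allFin to allFinL)

Pt : Set
Pt = ℤ × ℤ

_⊕_ : Pt → Pt → Pt
(a , b) ⊕ (c , d) = (a ℤ.+ c , b ℤ.+ d)

_·_ : ℤ → Pt → Pt
n · (a , b) = (n ℤ.* a , n ℤ.* b)

origin : Pt
origin = (ℤ.+ 0 , ℤ.+ 0)

_≟ᵖ_ : (p q : Pt) → Relation.Nullary.Dec (p ≡ q)
_≟ᵖ_ = ≡-dec ℤ._≟_ ℤ._≟_

-- u, v linearly independent over ℤ (equivalently over ℚ)
LinIndep : Pt → Pt → Set
LinIndep u v = (a b : ℤ) → (a · u) ⊕ (b · v) ≡ origin → (a ≡ ℤ.+ 0) × (b ≡ ℤ.+ 0)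

module GroupRing {c ℓ} (k : CommutativeRing c ℓ) where
  open CommutativeRing k renaming (Carrier to K)

  -- elements of k[ℤ²] as formal finite sums  Σ a·[x]
  KZ2 : Set c
  KZ2 = List (Pt × K)

  coeff : KZ2 → Pt → K
  coeff [] p = 0#
  coeff ((q , a) ∷ f) p with q ≟ᵖ p
  ... | yes _ = a + coeff f p
  ... | no _  = coeff f p

  _≈G_ : KZ2 → KZ2 → Set ℓ
  f ≈G g = (p : Pt) → coeff f p ≈ coeff g p

  _+G_ : KZ2 → KZ2 → KZ2
  f +G g = f ++ g

  -G_ : KZ2 → KZ2
  -G f = map (λ { (q , a) → (q , - a) }) f

  _*G_ : KZ2 → KZ2 → KZ2
  f *G g = concatMap (λ { (q , a) → map (λ { (r , b) → (q ⊕ r , a * b) }) g }) f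

  0G : KZ2
  0G = []

  ⟦_⟧ : Pt → KZ2
  ⟦ x ⟧ = (x , 1#) ∷ []

  1G : KZ2
  1G = ⟦ origin ⟧

  prodG : List KZ2 → KZ2
  prodG = foldr _*G_ 1G

  -- f ≡ g in k[ℤ²]/([d]-1), i.e. f - g lies in the ideal generated by [d]-1
  ModEq : Pt → KZ2 → KZ2 → Set (c ⊔ ℓ)
  ModEq d f g = Σ KZ2 λ h → (f +G (-G g)) ≈G ((⟦ d ⟧ +G (-G 1G)) *G h)

  module Lines {t : Data.Nat.ℕ} (d : Fin t → Pt) where
    D : Fin t → KZ2
    D i = prodG (map (λ j → ⟦ d j ⟧ +G (-G 1G))
                     (filter (λ j → ¬? (j FinP.≟ i)) (allFinL t)))

    -- L(ℤ², k) = ⊕_i k[ℤ²]/([d_i]-1), elements represented by tuples of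
    -- representatives, with componentwise (product ring) operations
    L : Set c
    L = Fin t → KZ2

    _≈L_ : L → L → Set (c ⊔ ℓ)
    x ≈L y = (i : Fin t) → ModEq (d i) (x i) (y i)

    _+L_ : L → L → L
    (x +L y) i = x i +G y i

    _*L_ : L → L → L
    (x *L y) i = x i *G y i

    0L : L
    0L i = 0G

    σ : KZ2 → L
    σ f i = f

    InImσ : L → Set (c ⊔ ℓ)
    InImσ x = Σ KZ2 λ f → x ≈L σ f

    record IsIdeal {p} (I : L → Set p) : Set (c ⊔ ℓ ⊔ p) where
      field
        respects : ∀ x y → x ≈L y → I x → I y
        has-0    : I 0L
        +-closed : ∀ x y → I x → I y → I (x +L y)
        *-closed : ∀ x y → I x → I (y *L x)

    𝔣 : L → Set (c ⊔ ℓ)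
    𝔣 x = (i : Fin t) → Σ KZ2 λ g → ModEq (d i) (x i) (D i *G g)

module Submission where

-- Write Δ a = [a] - 1 and Dᵢ = ∏_{j ≠ i} Δ dⱼ.  The theorem has three parts:
--   (1) 𝔣 = ⊕ᵢ Dᵢ·k[ℤ²]/(Δ dᵢ) is an ideal of L (componentwise closure);
--   (2) 𝔣 ⊆ im σ: if xᵢ ≡ Dᵢ gᵢ then x = σ(Σⱼ Dⱼ gⱼ), as Δ dᵢ divides Dⱼ for j ≠ i;
--   (3) every ideal I ⊆ im σ lies in 𝔣: for x ∈ I, the i-th unit of L times x
--       is σ f with f ≡ xᵢ mod Δ dᵢ and f ≡ 0 mod Δ dⱼ (j ≠ i), and the Δ dⱼ are
--       pairwise coprime (Δ dᵢ ∣ Δ dⱼ·h ⇒ Δ dᵢ ∣ h), so Dᵢ divides f.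
-- The real content is this cancellation law, proved with line sums: f is a
-- multiple of Δ b iff all its line sums in direction b vanish.  If Δ b divides
-- Δ a·h with a, b independent, the line sums of h are a-periodic, and a
-- multiple of a moves every line beyond the finite support of h.

open import Defs
open import Level using (Level)
open import Algebra.Bundles using (CommutativeRing)
open import Data.Nat using (ℕ)
open import Data.Fin using (Fin)
open import Data.Product using (_×_; _,_)
open import Relation.Nullary using (¬_)
open import Relation.Binary.PropositionalEquality using (_≢_)

module Plane where
  open import Data.Integer as ℤ using (ℤ; +_; -[1+_]; +[1+_]; ∣_∣; _+_; _*_; _-_; -_; _≤_; _<_; +≤+; +<+)
  import Data.Integer.Properties as ℤP
  open import Data.Integer.Tactic.RingSolver using (solve-∀)
  open import Algebra.Bundles using (AbelianGroup)
  open import Algebra.Properties.Group (AbelianGroup.group ℤP.+-0-abelianGroup) using (∙-cancelˡ)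
  open import Data.Nat as ℕ using (zero; suc)
  import Data.Nat.Properties as ℕP
  open import Data.Product using (∃; proj₁; proj₂)
  open import Data.Sum using (_⊎_; inj₁; inj₂)
  open import Data.Empty using (⊥-elim)
  open import Relation.Binary.Bundles using (Setoid)
  open import Relation.Binary.PropositionalEquality as ≡ using (_≡_; refl; cong; cong₂; module ≡-Reasoning)
  open import Relation.Nullary using (Dec; yes; no)
  open import Relation.Nullary.Decidable using (_⊎-dec_)

  ⊕-assoc : ∀ x y z → (x ⊕ y) ⊕ z ≡ x ⊕ (y ⊕ z)
  ⊕-assoc (x₁ , x₂) (y₁ , y₂) (z₁ , z₂) = cong₂ _,_ (ℤP.+-assoc x₁ y₁ z₁) (ℤP.+-assoc x₂ y₂ z₂)

  ⊕-comm : ∀ x y → x ⊕ y ≡ y ⊕ x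
  ⊕-comm (x₁ , x₂) (y₁ , y₂) = cong₂ _,_ (ℤP.+-comm x₁ y₁) (ℤP.+-comm x₂ y₂)

  ⊕-identityˡ : ∀ x → origin ⊕ x ≡ x
  ⊕-identityˡ (x₁ , x₂) = cong₂ _,_ (ℤP.+-identityˡ x₁) (ℤP.+-identityˡ x₂)

  ⊕-cancelˡ : ∀ a x y → a ⊕ x ≡ a ⊕ y → x ≡ y
  ⊕-cancelˡ (a₁ , a₂) (x₁ , x₂) (y₁ , y₂) eq =
    cong₂ _,_ (∙-cancelˡ a₁ x₁ y₁ (cong proj₁ eq)) (∙-cancelˡ a₂ x₂ y₂ (cong proj₂ eq))

  ·-distribʳ : ∀ m n v → (m + n) · v ≡ (m · v) ⊕ (n · v)
  ·-distribʳ m n (v₁ , v₂) = cong₂ _,_ (ℤP.*-distribʳ-+ v₁ m n) (ℤP.*-distribʳ-+ v₂ m n)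

  ·-zero : ∀ v → (+ 0) · v ≡ origin
  ·-zero (v₁ , v₂) = cong₂ _,_ (ℤP.*-zeroˡ v₁) (ℤP.*-zeroˡ v₂)

  ·-one : ∀ v → (+ 1) · v ≡ v
  ·-one (v₁ , v₂) = cong₂ _,_ (ℤP.*-identityˡ v₁) (ℤP.*-identityˡ v₂)

  zero-step : ∀ v y → ((+ 0) · v) ⊕ y ≡ y
  zero-step v y = ≡.trans (cong (_⊕ y) (·-zero v)) (⊕-identityˡ y)

  succ-step : ∀ n v y → ((+ suc n) · v) ⊕ y ≡ v ⊕ (((+ n) · v) ⊕ y)
  succ-step n v y = begin
    ((+ suc n) · v) ⊕ y              ≡⟨ cong (_⊕ y) (·-distribʳ (+ 1) (+ n) v) ⟩
    (((+ 1) · v) ⊕ ((+ n) · v)) ⊕ y    ≡⟨ ⊕-assoc ((+ 1) · v) ((+ n) · v) y ⟩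
    ((+ 1) · v) ⊕ (((+ n) · v) ⊕ y)    ≡⟨ cong (_⊕ (((+ n) · v) ⊕ y)) (·-one v) ⟩
    v ⊕ (((+ n) · v) ⊕ y)            ∎
    where open ≡-Reasoning

  module _ {s ℓ} (S : Setoid s ℓ) where
    open Setoid S

    orbit-invariant : ∀ (F : Pt → Carrier) v → (∀ y → F (v ⊕ y) ≈ F y)
                    → ∀ m y → F ((m · v) ⊕ y) ≈ F y
    orbit-invariant F v step (+ n) y = forward n y
      where
      forward : ∀ n y → F (((+ n) · v) ⊕ y) ≈ F y
      forward zero    y = reflexive (cong F (zero-step v y))
      forward (suc n) y = trans (reflexive (cong F (succ-step n v y)))
                                (trans (step _) (forward n y))
    orbit-invariant F v step -[1+ n ] y =
      trans (sym (orbit-invariant F v step (+ suc n) ((-[1+ n ] · v) ⊕ y)))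
            (reflexive (cong F cancel))
      where
      cancel : ((+ suc n) · v) ⊕ ((-[1+ n ] · v) ⊕ y) ≡ y
      cancel = begin
        ((+ suc n) · v) ⊕ ((-[1+ n ] · v) ⊕ y)  ≡⟨ ⊕-assoc ((+ suc n) · v) (-[1+ n ] · v) y ⟨
        (((+ suc n) · v) ⊕ (-[1+ n ] · v)) ⊕ y  ≡⟨ cong (_⊕ y) (·-distribʳ (+ suc n) -[1+ n ] v) ⟨
        (((+ suc n) + -[1+ n ]) · v) ⊕ y        ≡⟨ cong (λ m → (m · v) ⊕ y) (ℤP.+-inverseʳ (+ suc n)) ⟩
        ((+ 0) · v) ⊕ y                         ≡⟨ zero-step v y ⟩
        y                                     ∎
        where open ≡-Reasoning

  OnLine : Pt → Pt → Pt → Set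
  OnLine b x y = ∃ λ n → x ≡ (n · b) ⊕ y

  onLine-refl : ∀ b y → OnLine b y y
  onLine-refl b y = + 0 , ≡.sym (zero-step b y)

  onLine-sym : ∀ {b x y} → OnLine b x y → OnLine b y x
  onLine-sym {b} {x} {y} (n , x≡) = - n , ≡.sym (begin
    ((- n) · b) ⊕ x                ≡⟨ cong (((- n) · b) ⊕_) x≡ ⟩
    ((- n) · b) ⊕ ((n · b) ⊕ y)    ≡⟨ ⊕-assoc ((- n) · b) (n · b) y ⟨
    (((- n) · b) ⊕ (n · b)) ⊕ y    ≡⟨ cong (_⊕ y) (·-distribʳ (- n) n b) ⟨
    ((- n + n) · b) ⊕ y            ≡⟨ cong (λ m → (m · b) ⊕ y) (ℤP.+-inverseˡ n) ⟩
    ((+ 0) · b) ⊕ y                ≡⟨ zero-step b y ⟩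
    y                              ∎)
    where open ≡-Reasoning

  onLine-trans : ∀ {b x y z} → OnLine b x y → OnLine b y z → OnLine b x z
  onLine-trans {b} {x} {y} {z} (n , x≡) (m , y≡) = n + m , (begin
    x                              ≡⟨ x≡ ⟩
    (n · b) ⊕ y                    ≡⟨ cong ((n · b) ⊕_) y≡ ⟩
    (n · b) ⊕ ((m · b) ⊕ z)        ≡⟨ ⊕-assoc (n · b) (m · b) z ⟨
    ((n · b) ⊕ (m · b)) ⊕ z        ≡⟨ cong (_⊕ z) (·-distribʳ n m b) ⟨
    ((n + m) · b) ⊕ z              ∎)
    where open ≡-Reasoning

  onLine-step : ∀ b x → OnLine b (b ⊕ x) x
  onLine-step b x = + 1 , cong (_⊕ x) (≡.sym (·-one b))

  ⊕-left-comm : ∀ a u y → a ⊕ (u ⊕ y) ≡ u ⊕ (a ⊕ y)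
  ⊕-left-comm a u y = begin
    a ⊕ (u ⊕ y)   ≡⟨ ⊕-assoc a u y ⟨
    (a ⊕ u) ⊕ y   ≡⟨ cong (_⊕ y) (⊕-comm a u) ⟩
    (u ⊕ a) ⊕ y   ≡⟨ ⊕-assoc u a y ⟩
    u ⊕ (a ⊕ y)   ∎
    where open ≡-Reasoning

  onLine-translate : ∀ {b x y} a → OnLine b x y → OnLine b (a ⊕ x) (a ⊕ y)
  onLine-translate {b} {y = y} a (n , x≡) =
    n , ≡.trans (cong (a ⊕_) x≡) (⊕-left-comm a (n · b) y)

  onLine-untranslate : ∀ {b x y} a → OnLine b (a ⊕ x) (a ⊕ y) → OnLine b x y
  onLine-untranslate {b} {x} {y} a (n , ax≡) =
    n , ⊕-cancelˡ a x ((n · b) ⊕ y) (≡.trans ax≡ (≡.sym (⊕-left-comm a (n · b) y)))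

  bounded-search : ∀ {p} {P : ℤ → Set p} → (∀ n → Dec (P n))
                 → (N : ℕ) → (∀ n → P n → ∣ n ∣ ℕ.< N) → Dec (∃ P)
  bounded-search {P = P} P? N bounded
    with ℕP.anyUpTo? (λ m → P? (+ m) ⊎-dec P? (- + m)) N
  ... | yes (m , _ , inj₁ p) = yes (+ m , p)
  ... | yes (m , _ , inj₂ p) = yes (- + m , p)
  ... | no none = no λ (n , p) → none (∣ n ∣ , bounded n p , by-sign n p)
    where
    by-sign : ∀ n → P n → P (+ ∣ n ∣) ⊎ P (- + ∣ n ∣)
    by-sign (+ m)    p = inj₁ p
    by-sign -[1+ m ] p = inj₂ p

  multiplier-bound : ∀ n c w z → c ≢ + 0 → w ≡ n * c + z → ∣ n ∣ ℕ.≤ ∣ w - z ∣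
  multiplier-bound n c w z c≢0 w≡ = ≡.subst (∣ n ∣ ℕ.≤_) ∣nc∣≡∣w-z∣
    (ℕP.m≤m*n ∣ n ∣ ∣ c ∣ {{ℤ.≢-nonZero c≢0}})
    where
    cancel : ∀ u z → (u + z) - z ≡ u
    cancel = solve-∀
    ∣nc∣≡∣w-z∣ : ∣ n ∣ ℕ.* ∣ c ∣ ≡ ∣ w - z ∣
    ∣nc∣≡∣w-z∣ = ≡.sym (≡.trans (cong ∣_∣ (≡.trans (cong (_- z) w≡) (cancel (n * c) z)))
                               (ℤP.∣i*j∣≡∣i∣*∣j∣ n c))

  -- For b ≠ 0, lying on a line is decidable: the multiplier is bounded by the
  -- displacement in a coordinate where b is nonzero.
  onLine? : ∀ b → b ≢ origin → ∀ x y → Dec (OnLine b x y)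
  onLine? b@(b₁ , b₂) b≢0 x@(x₁ , x₂) y@(y₁ , y₂) =
    bounded-search (λ n → x ≟ᵖ ((n · b) ⊕ y)) (suc (∣ x₁ - y₁ ∣ ℕ.+ ∣ x₂ - y₂ ∣)) bounded
    where
    bounded : ∀ n → x ≡ (n · b) ⊕ y → ∣ n ∣ ℕ.< suc (∣ x₁ - y₁ ∣ ℕ.+ ∣ x₂ - y₂ ∣)
    bounded n x≡ with b₁ ℤ.≟ + 0 | b₂ ℤ.≟ + 0
    ... | yes b₁≡0 | yes b₂≡0 = ⊥-elim (b≢0 (cong₂ _,_ b₁≡0 b₂≡0))
    ... | no b₁≢0  | _ = ℕ.s≤s (ℕP.≤-trans (multiplier-bound n b₁ x₁ y₁ b₁≢0 (cong proj₁ x≡))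
                                           (ℕP.m≤m+n _ _))
    ... | yes _    | no b₂≢0 = ℕ.s≤s (ℕP.≤-trans (multiplier-bound n b₂ x₂ y₂ b₂≢0 (cong proj₂ x≡))
                                                (ℕP.m≤n+m _ _))

  -- The cross product with b: a linear functional on ℤ² that vanishes on b,
  -- hence is constant on every line in direction b.
  cross : Pt → Pt → ℤ
  cross (b₁ , b₂) (x₁ , x₂) = b₁ * x₂ - b₂ * x₁

  cross-⊕ : ∀ b x y → cross b (x ⊕ y) ≡ cross b x + cross b y
  cross-⊕ (b₁ , b₂) (x₁ , x₂) (y₁ , y₂) = additive b₁ b₂ x₁ x₂ y₁ y₂
    where
    additive : ∀ b₁ b₂ x₁ x₂ y₁ y₂ →
      b₁ * (x₂ + y₂) - b₂ * (x₁ + y₁) ≡ (b₁ * x₂ - b₂ * x₁) + (b₁ * y₂ - b₂ * y₁)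
    additive = solve-∀

  cross-· : ∀ b n x → cross b (n · x) ≡ n * cross b x
  cross-· (b₁ , b₂) n (x₁ , x₂) = homogeneous b₁ b₂ n x₁ x₂
    where
    homogeneous : ∀ b₁ b₂ n x₁ x₂ → b₁ * (n * x₂) - b₂ * (n * x₁) ≡ n * (b₁ * x₂ - b₂ * x₁)
    homogeneous = solve-∀

  cross-self : ∀ b → cross b b ≡ + 0
  cross-self (b₁ , b₂) = alternating b₁ b₂
    where
    alternating : ∀ b₁ b₂ → b₁ * b₂ - b₂ * b₁ ≡ + 0
    alternating = solve-∀

  cross-onLine : ∀ {b x y} → OnLine b x y → cross b x ≡ cross b y
  cross-onLine {b} {x} {y} (n , x≡) = begin
    cross b x                            ≡⟨ cong (cross b) x≡ ⟩
    cross b ((n · b) ⊕ y)                ≡⟨ cross-⊕ b (n · b) y ⟩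
    cross b (n · b) + cross b y          ≡⟨ cong (_+ cross b y) (cross-· b n b) ⟩
    n * cross b b + cross b y            ≡⟨ cong (λ c → n * c + cross b y) (cross-self b) ⟩
    n * + 0 + cross b y                  ≡⟨ cong (_+ cross b y) (ℤP.*-zeroʳ n) ⟩
    + 0 + cross b y                      ≡⟨ ℤP.+-identityˡ (cross b y) ⟩
    cross b y                            ∎
    where open ≡-Reasoning

  cross-indep : ∀ a b → LinIndep a b → cross b a ≢ + 0
  cross-indep a@(a₁ , a₂) b@(b₁ , b₂) indep cross≡0 = b≢0 (cong₂ _,_ b₁≡0 b₂≡0)
    where
    b≢0 : b ≢ origin
    b≢0 b≡0 with indep (+ 0) (+ 1)
      (≡.trans (cong₂ _⊕_ (·-zero a) (·-one b)) (≡.trans (⊕-identityˡ b) b≡0))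
    ... | _ , ()
    vanish : ∀ u v → u * v + (- v) * u ≡ + 0
    vanish = solve-∀
    first : ∀ a₁ a₂ b₁ b₂ → b₁ * a₂ + (- a₁) * b₂ ≡ b₁ * a₂ - b₂ * a₁
    first = solve-∀
    second : ∀ a₁ a₂ b₁ b₂ → b₂ * a₁ + (- a₂) * b₁ ≡ - (b₁ * a₂ - b₂ * a₁)
    second = solve-∀
    b₁≡0 : b₁ ≡ + 0
    b₁≡0 = proj₁ (indep b₁ (- a₁)
             (cong₂ _,_ (vanish b₁ a₁) (≡.trans (first a₁ a₂ b₁ b₂) cross≡0)))
    b₂≡0 : b₂ ≡ + 0
    b₂≡0 = proj₁ (indep b₂ (- a₂)
             (cong₂ _,_ (≡.trans (second a₁ a₂ b₁ b₂) (cong -_ cross≡0)) (vanish b₂ a₂)))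

  progression-unbounded : ∀ c v (B : ℕ) → c ≢ + 0 → ∃ λ m → + B < m * c + v
  progression-unbounded c v B c≢0 = c * + N , (begin-strict
    + B                               <⟨ +<+ (ℕP.n<1+n B) ⟩
    + suc B                           ≡⟨ ℤP.+-identityʳ (+ suc B) ⟨
    + suc B + + 0                     ≤⟨ ℤP.+-monoʳ-≤ (+ suc B) (abs-plus-nonneg v) ⟩
    + suc B + (+ ∣ v ∣ + v)           ≡⟨ ℤP.+-assoc (+ suc B) (+ ∣ v ∣) v ⟨
    + N + v                           ≡⟨ cong (_+ v) (ℤP.*-identityʳ (+ N)) ⟨
    + N * + 1 + v                     ≤⟨ ℤP.+-monoˡ-≤ v (ℤP.*-monoˡ-≤-nonNeg (+ N) (square-positive c c≢0)) ⟩
    + N * (c * c) + v                 ≡⟨ cong (_+ v) (rearrange (+ N) c) ⟩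
    c * + N * c + v                   ∎)
    where
    open ℤP.≤-Reasoning
    N : ℕ
    N = suc B ℕ.+ ∣ v ∣
    abs-plus-nonneg : ∀ v → + 0 ≤ + ∣ v ∣ + v
    abs-plus-nonneg (+ n)    = +≤+ ℕ.z≤n
    abs-plus-nonneg -[1+ n ] = ℤP.≤-reflexive (≡.sym (ℤP.+-inverseʳ (+ suc n)))
    square-positive : ∀ c → c ≢ + 0 → + 1 ≤ c * c
    square-positive (+ zero)  c≢0 = ⊥-elim (c≢0 refl)
    square-positive +[1+ n ]  _   = +≤+ (ℕ.s≤s ℕ.z≤n)
    square-positive -[1+ n ]  _   = +≤+ (ℕ.s≤s ℕ.z≤n)
    rearrange : ∀ n c → n * (c * c) ≡ c * n * c
    rearrange = solve-∀

module Multiples {c ℓ} (R : CommutativeRing c ℓ) where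
  open import Level using (_⊔_)
  open import Data.List using (List; []; _∷_; foldr; map)
  open import Data.List.Relation.Unary.All using (All; []; _∷_)
  open import Data.List.Relation.Unary.AllPairs using ([]; _∷_)
  open import Data.List.Relation.Unary.Any using (here; there)
  open import Data.List.Relation.Unary.Unique.Propositional using (Unique)
  open import Data.List.Membership.Propositional using (_∈_)
  open import Data.Product using (Σ)
  open import Data.Nat using (suc)
  open import Data.Fin.Properties using (punchInᵢ≢i)
  open import Data.Vec.Functional using (removeAt)
  open import Relation.Binary.PropositionalEquality as ≡ using ()
  open import Relation.Binary.Bundles using (Setoid)

  open CommutativeRing R
  open import Relation.Binary.Reasoning.Setoid setoid
  open import Algebra.Properties.Ring ring using (-‿distribʳ-*)
  open import Algebra.Properties.AbelianGroup +-abelianGroup using (⁻¹-anti-homo‿-; ⁻¹-∙-comm)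
  open import Algebra.Properties.CommutativeSemigroup +-commutativeSemigroup using (interchange)
  open import Algebra.Properties.CommutativeSemigroup *-commutativeSemigroup using (x∙yz≈y∙xz)
  open import Algebra.Properties.CommutativeMonoid.Sum +-commutativeMonoid using (sum; sum-remove)

  Multiple : Carrier → Carrier → Set (c ⊔ ℓ)
  Multiple δ f = Σ Carrier λ u → f ≈ δ * u

  Congruent : Carrier → Carrier → Carrier → Set (c ⊔ ℓ)
  Congruent δ f g = Multiple δ (f + - g)

  module Modulo (δ : Carrier) where

    multiple-resp : ∀ {f g} → f ≈ g → Multiple δ f → Multiple δ g
    multiple-resp f≈g (u , f≈δu) = u , trans (sym f≈g) f≈δu

    multiple-0 : Multiple δ 0#
    multiple-0 = 0# , sym (zeroʳ δ)

    multiple-+ : ∀ {f g} → Multiple δ f → Multiple δ g → Multiple δ (f + g)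
    multiple-+ (u , f≈) (v , g≈) = u + v , trans (+-cong f≈ g≈) (sym (distribˡ δ u v))

    multiple-neg : ∀ {f} → Multiple δ f → Multiple δ (- f)
    multiple-neg (u , f≈) = - u , trans (-‿cong f≈) (-‿distribʳ-* δ u)

    multiple-*ˡ : ∀ g {f} → Multiple δ f → Multiple δ (g * f)
    multiple-*ˡ g (u , f≈) = g * u , trans (*-congˡ f≈) (x∙yz≈y∙xz g δ u)

    congruent-reflexive : ∀ {f g} → f ≈ g → Congruent δ f g
    congruent-reflexive {f} {g} f≈g =
      multiple-resp (trans (sym (-‿inverseʳ g)) (+-congʳ (sym f≈g))) multiple-0

    congruent-sym : ∀ {f g} → Congruent δ f g → Congruent δ g f
    congruent-sym {f} {g} f≡g = multiple-resp (⁻¹-anti-homo‿- f g) (multiple-neg f≡g)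

    congruent-trans : ∀ {f g h} → Congruent δ f g → Congruent δ g h → Congruent δ f h
    congruent-trans {f} {g} {h} f≡g g≡h = multiple-resp telescope (multiple-+ f≡g g≡h)
      where
      telescope : (f - g) + (g - h) ≈ f - h
      telescope = begin
        (f - g) + (g - h)    ≈⟨ +-assoc f (- g) (g - h) ⟩
        f + (- g + (g - h))  ≈⟨ +-congˡ (+-assoc (- g) g (- h)) ⟨
        f + ((- g + g) - h)  ≈⟨ +-congˡ (+-congʳ (-‿inverseˡ g)) ⟩
        f + (0# - h)         ≈⟨ +-congˡ (+-identityˡ (- h)) ⟩
        f - h                ∎

    congruent-+ : ∀ {f f′ g g′} → Congruent δ f f′ → Congruent δ g g′
                → Congruent δ (f + g) (f′ + g′)
    congruent-+ {f} {f′} {g} {g′} f≡ g≡ = multiple-resp regroup (multiple-+ f≡ g≡)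
      where
      regroup : (f - f′) + (g - g′) ≈ (f + g) - (f′ + g′)
      regroup = begin
        (f - f′) + (g - g′)      ≈⟨ interchange f (- f′) g (- g′) ⟩
        (f + g) + (- f′ - g′)    ≈⟨ +-congˡ (⁻¹-∙-comm f′ g′) ⟩
        (f + g) - (f′ + g′)      ∎

    congruent-*ˡ : ∀ y {f g} → Congruent δ f g → Congruent δ (y * f) (y * g)
    congruent-*ˡ y {f} {g} f≡g = multiple-resp distribute (multiple-*ˡ y f≡g)
      where
      distribute : y * (f - g) ≈ y * f - y * g
      distribute = trans (distribˡ y f (- g)) (+-congˡ (sym (-‿distribʳ-* y g)))

    congruent-multiple : ∀ {f g} → Congruent δ f g → Multiple δ g → Multiple δ f
    congruent-multiple {f} {g} f≡g g-mult = multiple-resp cancel (multiple-+ f≡g g-mult)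
      where
      cancel : (f - g) + g ≈ f
      cancel = trans (+-assoc f (- g) g) (trans (+-congˡ (-‿inverseˡ g)) (+-identityʳ f))

    congruent-to-0 : ∀ {f} → Congruent δ 0# f → Multiple δ f
    congruent-to-0 {f} 0≡f = congruent-multiple (congruent-sym 0≡f) multiple-0

    MultipleMod : Carrier → Carrier → Set (c ⊔ ℓ)
    MultipleMod D x = Σ Carrier λ g → Congruent δ x (D * g)

    multipleMod-resp : ∀ D {x y} → Congruent δ x y → MultipleMod D x → MultipleMod D y
    multipleMod-resp D x≡y (g , x≡Dg) = g , congruent-trans (congruent-sym x≡y) x≡Dg

    multipleMod-0 : ∀ D → MultipleMod D 0#
    multipleMod-0 D = 0# , congruent-reflexive (sym (zeroʳ D))

    multipleMod-+ : ∀ D {x y} → MultipleMod D x → MultipleMod D y → MultipleMod D (x + y)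
    multipleMod-+ D (g , x≡Dg) (g′ , y≡Dg′) =
      g + g′ , congruent-trans (congruent-+ x≡Dg y≡Dg′) (congruent-reflexive (sym (distribˡ D g g′)))

    multipleMod-*ˡ : ∀ D y {x} → MultipleMod D x → MultipleMod D (y * x)
    multipleMod-*ˡ D y (g , x≡Dg) =
      y * g , congruent-trans (congruent-*ˡ y x≡Dg) (congruent-reflexive (x∙yz≈y∙xz y D g))

    sum-multiple : ∀ {n} (G : Fin n → Carrier) → (∀ j → Multiple δ (G j)) → Multiple δ (sum G)
    sum-multiple {0}     G _      = multiple-0
    sum-multiple {suc n} G G-mult = multiple-+ (G-mult _) (sum-multiple (λ j → G (Fin.suc j)) (λ j → G-mult _))

    sum-congruent-term : ∀ {n} (G : Fin n → Carrier) i → (∀ j → j ≢ i → Multiple δ (G j))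
                       → Congruent δ (sum G) (G i)
    sum-congruent-term {suc n} G i others = multiple-resp isolate
      (sum-multiple (removeAt G i) (λ j → others _ (punchInᵢ≢i i j)))
      where
      rest : Carrier
      rest = sum (removeAt G i)
      isolate : rest ≈ sum G - G i
      isolate = begin
        rest                  ≈⟨ +-identityʳ rest ⟨
        rest + 0#             ≈⟨ +-congˡ (-‿inverseʳ (G i)) ⟨
        rest + (G i - G i)    ≈⟨ +-assoc rest (G i) (- G i) ⟨
        (rest + G i) - G i    ≈⟨ +-congʳ (+-comm rest (G i)) ⟩
        (G i + rest) - G i    ≈⟨ +-congʳ (sum-remove G) ⟨
        sum G - G i           ∎

  congruence-setoid : Carrier → Setoid c (c ⊔ ℓ)
  congruence-setoid δ = record
    { Carrier       = Carrier
    ; _≈_           = Congruent δ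
    ; isEquivalence = record
      { refl  = congruent-reflexive refl
      ; sym   = congruent-sym
      ; trans = congruent-trans } }
    where open Modulo δ

  product : List Carrier → Carrier
  product = foldr _*_ 1#

  Cancellable : Carrier → Carrier → Set (c ⊔ ℓ)
  Cancellable δ ε = ∀ h → Multiple δ (ε * h) → Multiple δ h

  module _ {i} {I : Set i} (ι : I → Carrier) where

    factor-divides-product : ∀ {j js} → j ∈ js → Multiple (ι j) (product (map ι js))
    factor-divides-product {js = j ∷ js}  (here ≡.refl) = product (map ι js) , refl
    factor-divides-product {j} {j′ ∷ js} (there j∈js)  =
      Modulo.multiple-*ˡ (ι j) (ι j′) (factor-divides-product j∈js)

    module _ (coprime : ∀ i j → i ≢ j → Cancellable (ι i) (ι j)) where

      cancel-product : ∀ i js → All (i ≢_) js → Cancellable (ι i) (product (map ι js))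
      cancel-product i []       []            h m = Modulo.multiple-resp (ι i) (*-identityˡ h) m
      cancel-product i (j ∷ js) (i≢j ∷ i∉js) h m =
        cancel-product i js i∉js h
          (coprime i j i≢j (product (map ι js) * h)
            (Modulo.multiple-resp (ι i) (*-assoc (ι j) (product (map ι js)) h) m))

      product-divides : ∀ {f} js → Unique js → All (λ j → Multiple (ι j) f) js
                      → Multiple (product (map ι js)) f
      product-divides {f} []       _                  _            = f , sym (*-identityˡ f)
      product-divides {f} (j ∷ js) (j∉js ∷ distinct) (j∣f ∷ js∣f)
        with product-divides js distinct js∣f
      ... | g , f≈Pg with cancel-product j js j∉js g (Modulo.multiple-resp (ι j) f≈Pg j∣f)
      ...   | v , g≈ιv = v , (begin
        f                     ≈⟨ f≈Pg ⟩
        P * g                 ≈⟨ *-congˡ g≈ιv ⟩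
        P * (ι j * v)         ≈⟨ x∙yz≈y∙xz P (ι j) v ⟩
        ι j * (P * v)         ≈⟨ *-assoc (ι j) P v ⟨
        ι j * P * v           ∎)
        where
        P : Carrier
        P = product (map ι js)

module ListSums {c ℓ} (k : CommutativeRing c ℓ) where
  open import Data.List using (List; []; _∷_; _++_; map)
  open import Relation.Binary.PropositionalEquality as ≡ using (_≡_)

  open CommutativeRing k
  open import Relation.Binary.Reasoning.Setoid setoid
  open import Algebra.Properties.Ring ring using (-0#≈0#)
  open import Algebra.Properties.AbelianGroup +-abelianGroup using (⁻¹-∙-comm)
  open import Algebra.Properties.CommutativeSemigroup +-commutativeSemigroup using (interchange)

  Σl : ∀ {a} {A : Set a} → List A → (A → Carrier) → Carrier
  Σl []       W = 0#
  Σl (x ∷ xs) W = W x + Σl xs W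

  module _ {a} {A : Set a} where

    Σl-cong : ∀ (xs : List A) {W V} → (∀ x → W x ≈ V x) → Σl xs W ≈ Σl xs V
    Σl-cong []       W≈V = refl
    Σl-cong (x ∷ xs) W≈V = +-cong (W≈V x) (Σl-cong xs W≈V)

    Σl-++ : ∀ (xs ys : List A) W → Σl (xs ++ ys) W ≈ Σl xs W + Σl ys W
    Σl-++ []       ys W = sym (+-identityˡ _)
    Σl-++ (x ∷ xs) ys W = trans (+-congˡ (Σl-++ xs ys W)) (sym (+-assoc _ _ _))

    Σl-map : ∀ {b} {B : Set b} (φ : B → A) xs W → Σl (map φ xs) W ≡ Σl xs (λ x → W (φ x))
    Σl-map φ []       W = ≡.refl
    Σl-map φ (x ∷ xs) W = ≡.cong (W (φ x) +_) (Σl-map φ xs W)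

    Σl-0 : ∀ (xs : List A) → Σl xs (λ _ → 0#) ≈ 0#
    Σl-0 []       = refl
    Σl-0 (x ∷ xs) = trans (+-identityˡ _) (Σl-0 xs)

    Σl-+ : ∀ (xs : List A) W V → Σl xs (λ x → W x + V x) ≈ Σl xs W + Σl xs V
    Σl-+ []       W V = sym (+-identityˡ 0#)
    Σl-+ (x ∷ xs) W V = trans (+-congˡ (Σl-+ xs W V)) (interchange _ _ _ _)

    Σl-neg : ∀ (xs : List A) W → Σl xs (λ x → - W x) ≈ - Σl xs W
    Σl-neg []       W = sym -0#≈0#
    Σl-neg (x ∷ xs) W = trans (+-congˡ (Σl-neg xs W)) (⁻¹-∙-comm _ _)

    Σl-*ˡ : ∀ (xs : List A) a W → Σl xs (λ x → a * W x) ≈ a * Σl xs W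
    Σl-*ˡ []       a W = sym (zeroʳ a)
    Σl-*ˡ (x ∷ xs) a W = trans (+-congˡ (Σl-*ˡ xs a W)) (sym (distribˡ _ _ _))

  Σl-swap : ∀ {a b} {A : Set a} {B : Set b} (xs : List A) (ys : List B) (W : A → B → Carrier)
          → Σl xs (λ x → Σl ys (W x)) ≈ Σl ys (λ y → Σl xs (λ x → W x y))
  Σl-swap []       ys W = sym (Σl-0 ys)
  Σl-swap (x ∷ xs) ys W = begin
    Σl ys (W x) + Σl xs (λ x → Σl ys (W x))         ≈⟨ +-congˡ (Σl-swap xs ys W) ⟩
    Σl ys (W x) + Σl ys (λ y → Σl xs (λ x → W x y)) ≈⟨ Σl-+ ys (W x) _ ⟨
    Σl ys (λ y → W x y + Σl xs (λ x → W x y))       ∎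

module Indicator {c ℓ} (k : CommutativeRing c ℓ) where
  open import Relation.Binary.PropositionalEquality as ≡ using (_≡_)
  open import Relation.Nullary using (Dec; yes; no)
  open import Data.Empty using (⊥-elim)

  open CommutativeRing k

  indicator : ∀ {p} {P : Set p} → Dec P → Carrier
  indicator (yes _) = 1#
  indicator (no _)  = 0#

  indicator-yes : ∀ {p} {P : Set p} → P → (P? : Dec P) → indicator P? ≡ 1#
  indicator-yes _ (yes _)  = ≡.refl
  indicator-yes p (no ¬p) = ⊥-elim (¬p p)

  indicator-no : ∀ {p} {P : Set p} → ¬ P → (P? : Dec P) → indicator P? ≡ 0#
  indicator-no ¬p (yes p) = ⊥-elim (¬p p)
  indicator-no _  (no _)  = ≡.refl

  indicator-cong : ∀ {p q} {P : Set p} {Q : Set q} → (P → Q) → (Q → P)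
                 → (P? : Dec P) (Q? : Dec Q) → indicator P? ≡ indicator Q?
  indicator-cong P→Q Q→P (yes p) Q? = ≡.sym (indicator-yes (P→Q p) Q?)
  indicator-cong P→Q Q→P (no ¬p) Q? = ≡.sym (indicator-no (λ q → ¬p (Q→P q)) Q?)

-- Pairing formal sums with functions on ℤ².  Two formal sums have the same
-- coefficients iff they pair equally with every function; this reduces the
-- ring laws of k[ℤ²] to those of k.
module Evaluation {c ℓ} (k : CommutativeRing c ℓ) where
  open Plane
  open import Data.Nat as ℕ using (suc)
  import Data.Nat.Properties as ℕP
  open import Data.List using ([]; _∷_; map; length)
  open import Data.List.Properties using (++-assoc; ++-identityʳ)
  open import Data.Product using (proj₁; proj₂)
  open import Relation.Binary.PropositionalEquality as ≡ using (_≡_)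
  open import Relation.Nullary using (yes; no)
  open import Data.Empty using (⊥-elim)

  open CommutativeRing k renaming (Carrier to K)
  open GroupRing k
  open ListSums k
  open Indicator k
  open import Relation.Binary.Reasoning.Setoid setoid
  open import Algebra.Properties.Ring ring using (-‿distribˡ-*)
  open import Algebra.Properties.CommutativeSemigroup +-commutativeSemigroup using () renaming (x∙yz≈y∙xz to +-left-comm)
  open import Algebra.Properties.CommutativeSemigroup *-commutativeSemigroup using () renaming (x∙yz≈y∙xz to *-left-comm)
  open import Algebra.Properties.Group +-group using (x∙y⁻¹≈ε⇒x≈y)

  ev : KZ2 → (Pt → K) → K
  ev f F = Σl f (λ e → proj₂ e * F (proj₁ e))

  ev-cong : ∀ f {F G} → (∀ q → F q ≈ G q) → ev f F ≈ ev f G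
  ev-cong f F≈G = Σl-cong f (λ e → *-congˡ (F≈G (proj₁ e)))

  ev-++ : ∀ f g F → ev (f +G g) F ≈ ev f F + ev g F
  ev-++ f g F = Σl-++ f g _

  ev-neg : ∀ f F → ev (-G f) F ≈ - ev f F
  ev-neg f F = begin
    ev (-G f) F                                 ≡⟨ Σl-map _ f _ ⟩
    Σl f (λ e → (- proj₂ e) * F (proj₁ e))      ≈⟨ Σl-cong f (λ e → sym (-‿distribˡ-* _ _)) ⟩
    Σl f (λ e → - (proj₂ e * F (proj₁ e)))      ≈⟨ Σl-neg f _ ⟩
    - ev f F                                    ∎

  ev-+F : ∀ f F G → ev f (λ q → F q + G q) ≈ ev f F + ev f G
  ev-+F f F G = trans (Σl-cong f (λ e → distribˡ _ _ _)) (Σl-+ f _ _)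

  ev-*F : ∀ f a F → ev f (λ q → a * F q) ≈ a * ev f F
  ev-*F f a F = trans (Σl-cong f (λ e → *-left-comm _ _ _)) (Σl-*ˡ f a _)

  ev-monomial* : ∀ q a g F
    → ev (map (λ e → (q ⊕ proj₁ e , a * proj₂ e)) g) F ≈ a * ev g (λ r → F (q ⊕ r))
  ev-monomial* q a g F = begin
    ev (map (λ e → (q ⊕ proj₁ e , a * proj₂ e)) g) F ≡⟨ Σl-map _ g _ ⟩
    Σl g (λ e → (a * proj₂ e) * F (q ⊕ proj₁ e))     ≈⟨ Σl-cong g (λ e → *-assoc _ _ _) ⟩
    Σl g (λ e → a * (proj₂ e * F (q ⊕ proj₁ e)))     ≈⟨ Σl-*ˡ g a _ ⟩
    a * ev g (λ r → F (q ⊕ r))                       ∎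

  ev-* : ∀ f g F → ev (f *G g) F ≈ ev f (λ q → ev g (λ r → F (q ⊕ r)))
  ev-* []             g F = refl
  ev-* ((q , a) ∷ f) g F =
    trans (ev-++ (map (λ e → (q ⊕ proj₁ e , a * proj₂ e)) g) (f *G g) F)
          (+-cong (ev-monomial* q a g F) (ev-* f g F))

  ev-swap : ∀ f g (H : Pt → Pt → K)
          → ev f (λ q → ev g (λ r → H q r)) ≈ ev g (λ r → ev f (λ q → H q r))
  ev-swap f g H = begin
    Σl f (λ e → proj₂ e * ev g (H (proj₁ e)))
      ≈⟨ Σl-cong f (λ e → sym (ev-*F g (proj₂ e) _)) ⟩
    Σl f (λ e → Σl g (λ e′ → proj₂ e′ * (proj₂ e * H (proj₁ e) (proj₁ e′))))
      ≈⟨ Σl-swap f g _ ⟩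
    Σl g (λ e′ → Σl f (λ e → proj₂ e′ * (proj₂ e * H (proj₁ e) (proj₁ e′))))
      ≈⟨ Σl-cong g (λ e′ → Σl-*ˡ f (proj₂ e′) _) ⟩
    Σl g (λ e′ → proj₂ e′ * ev f (λ q → H q (proj₁ e′)))
      ∎

  ev-⟦⟧ : ∀ x F → ev ⟦ x ⟧ F ≈ F x
  ev-⟦⟧ x F = trans (+-identityʳ _) (*-identityˡ _)

  Δ : Pt → KZ2
  Δ a = ⟦ a ⟧ +G (-G 1G)

  ev-Δ* : ∀ a u F → ev (Δ a *G u) F ≈ ev u (λ r → F (a ⊕ r)) - ev u F
  ev-Δ* a u F = begin
    ev (Δ a *G u) F                              ≈⟨ ev-* (Δ a) u F ⟩
    ev (Δ a) G                                   ≈⟨ ev-++ ⟦ a ⟧ (-G 1G) G ⟩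
    ev ⟦ a ⟧ G + ev (-G 1G) G                    ≈⟨ +-cong (ev-⟦⟧ a G) (trans (ev-neg 1G G) (-‿cong (ev-⟦⟧ origin G))) ⟩
    G a - G origin                               ≈⟨ +-congˡ (-‿cong (ev-cong u (λ r → reflexive (≡.cong F (⊕-identityˡ r))))) ⟩
    ev u (λ r → F (a ⊕ r)) - ev u F              ∎
    where
    G : Pt → K
    G q = ev u (λ r → F (q ⊕ r))

  push : (Pt → Pt) → KZ2 → KZ2
  push π = map (λ e → (π (proj₁ e) , proj₂ e))

  ev-push : ∀ π f F → ev (push π f) F ≡ ev f (λ q → F (π q))
  ev-push π f F = Σl-map _ f _

  δ : Pt → Pt → K
  δ p q = indicator (q ≟ᵖ p)

  coeff-ev : ∀ f p → coeff f p ≈ ev f (δ p)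
  coeff-ev []            p = refl
  coeff-ev ((q , a) ∷ f) p with q ≟ᵖ p
  ... | yes _ = +-cong (sym (*-identityʳ a)) (coeff-ev f p)
  ... | no _  = trans (sym (+-identityˡ _)) (+-cong (sym (zeroʳ a)) (coeff-ev f p))

  coeff-here : ∀ q a f → coeff ((q , a) ∷ f) q ≈ a + coeff f q
  coeff-here q a f with q ≟ᵖ q
  ... | yes _   = refl
  ... | no q≢q = ⊥-elim (q≢q ≡.refl)

  coeff-there : ∀ r p a f → r ≢ p → coeff ((r , a) ∷ f) p ≡ coeff f p
  coeff-there r p a f r≢p with r ≟ᵖ p
  ... | yes r≡p = ⊥-elim (r≢p r≡p)
  ... | no _    = ≡.refl

  remove : Pt → KZ2 → KZ2
  remove q []            = []
  remove q ((r , a) ∷ f) with r ≟ᵖ q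
  ... | yes _ = remove q f
  ... | no _  = (r , a) ∷ remove q f

  length-remove : ∀ q f → length (remove q f) ℕ.≤ length f
  length-remove q []            = ℕ.z≤n
  length-remove q ((r , a) ∷ f) with r ≟ᵖ q
  ... | yes _ = ℕP.m≤n⇒m≤1+n (length-remove q f)
  ... | no _  = ℕ.s≤s (length-remove q f)

  coeff-remove-≢ : ∀ q p f → p ≢ q → coeff (remove q f) p ≈ coeff f p
  coeff-remove-≢ q p []            p≢q = refl
  coeff-remove-≢ q p ((r , a) ∷ f) p≢q with r ≟ᵖ q
  ... | yes ≡.refl = trans (coeff-remove-≢ r p f p≢q)
                           (reflexive (≡.sym (coeff-there r p a f (λ r≡p → p≢q (≡.sym r≡p)))))
  ... | no _ with r ≟ᵖ p
  ...   | yes _ = +-congˡ (coeff-remove-≢ q p f p≢q)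
  ...   | no _  = coeff-remove-≢ q p f p≢q

  coeff-remove-≡ : ∀ q f → coeff (remove q f) q ≈ 0#
  coeff-remove-≡ q []            = refl
  coeff-remove-≡ q ((r , a) ∷ f) with r ≟ᵖ q
  ... | yes _   = coeff-remove-≡ q f
  ... | no r≢q = trans (reflexive (coeff-there r q a (remove q f) r≢q)) (coeff-remove-≡ q f)

  ev-remove : ∀ q f F → ev f F ≈ coeff f q * F q + ev (remove q f) F
  ev-remove q []            F = sym (trans (+-identityʳ _) (zeroˡ _))
  ev-remove q ((r , a) ∷ f) F with r ≟ᵖ q
  ... | yes ≡.refl = begin
    a * F r + ev f F                                  ≈⟨ +-congˡ (ev-remove r f F) ⟩
    a * F r + (coeff f r * F r + ev (remove r f) F)   ≈⟨ +-assoc _ _ _ ⟨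
    (a * F r + coeff f r * F r) + ev (remove r f) F   ≈⟨ +-congʳ (distribʳ _ _ _) ⟨
    (a + coeff f r) * F r + ev (remove r f) F         ∎
  ... | no _ = begin
    a * F r + ev f F                                  ≈⟨ +-congˡ (ev-remove q f F) ⟩
    a * F r + (coeff f q * F q + ev (remove q f) F)   ≈⟨ +-left-comm _ _ _ ⟩
    coeff f q * F q + (a * F r + ev (remove q f) F)   ∎

  remove-head : ∀ q a f → remove q ((q , a) ∷ f) ≡ remove q f
  remove-head q a f with q ≟ᵖ q
  ... | yes _   = ≡.refl
  ... | no q≢q = ⊥-elim (q≢q ≡.refl)

  remove-vanishing : ∀ q f → coeff f q ≈ 0# → remove q f ≈G f
  remove-vanishing q f coeff≈0 p with p ≟ᵖ q
  ... | yes ≡.refl = trans (coeff-remove-≡ q f) (sym coeff≈0)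
  ... | no p≢q     = coeff-remove-≢ q p f p≢q

  vanishing-ev : ∀ n f → length f ℕ.≤ n → (∀ p → coeff f p ≈ 0#) → ∀ F → ev f F ≈ 0#
  vanishing-ev _       []              _         _      F = refl
  vanishing-ev (suc n) f@((q , a) ∷ f′) (ℕ.s≤s ≤n) coeff≈0 F = begin
    ev f F                                ≈⟨ ev-remove q f F ⟩
    coeff f q * F q + ev (remove q f) F   ≈⟨ +-cong (trans (*-congʳ (coeff≈0 q)) (zeroˡ _))
                                                    (vanishing-ev n (remove q f) shorter coeff′≈0 F) ⟩
    0# + 0#                               ≈⟨ +-identityˡ 0# ⟩
    0#                                    ∎
    where
    shorter : length (remove q f) ℕ.≤ n
    shorter = ≡.subst (λ l → length l ℕ.≤ n) (≡.sym (remove-head q a f′))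
                (ℕP.≤-trans (length-remove q f′) ≤n)
    coeff′≈0 : ∀ p → coeff (remove q f) p ≈ 0#
    coeff′≈0 p with p ≟ᵖ q
    ... | yes ≡.refl = coeff-remove-≡ q f
    ... | no p≢q     = trans (coeff-remove-≢ q p f p≢q) (coeff≈0 p)

  coeff-+ : ∀ f g p → coeff (f +G g) p ≈ coeff f p + coeff g p
  coeff-+ f g p = begin
    coeff (f +G g) p                 ≈⟨ coeff-ev (f +G g) p ⟩
    ev (f +G g) (δ p)                ≈⟨ ev-++ f g (δ p) ⟩
    ev f (δ p) + ev g (δ p)          ≈⟨ +-cong (coeff-ev f p) (coeff-ev g p) ⟨
    coeff f p + coeff g p            ∎

  coeff-neg : ∀ f p → coeff (-G f) p ≈ - coeff f p
  coeff-neg f p = begin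
    coeff (-G f) p                   ≈⟨ coeff-ev (-G f) p ⟩
    ev (-G f) (δ p)                  ≈⟨ ev-neg f (δ p) ⟩
    - ev f (δ p)                     ≈⟨ -‿cong (coeff-ev f p) ⟨
    - coeff f p                      ∎

  pairings⇒coeffs : ∀ f g → (∀ F → ev f F ≈ ev g F) → f ≈G g
  pairings⇒coeffs f g f≈g p = trans (coeff-ev f p) (trans (f≈g (δ p)) (sym (coeff-ev g p)))

  coeffs⇒pairings : ∀ f g → f ≈G g → ∀ F → ev f F ≈ ev g F
  coeffs⇒pairings f g f≈g F = x∙y⁻¹≈ε⇒x≈y _ _ (begin
    ev f F - ev g F                  ≈⟨ +-congˡ (ev-neg g F) ⟨
    ev f F + ev (-G g) F             ≈⟨ ev-++ f (-G g) F ⟨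
    ev (f +G (-G g)) F               ≈⟨ vanishing-ev _ (f +G (-G g)) ℕP.≤-refl difference≈0 F ⟩
    0#                               ∎)
    where
    difference≈0 : ∀ p → coeff (f +G (-G g)) p ≈ 0#
    difference≈0 p = begin
      coeff (f +G (-G g)) p          ≈⟨ coeff-+ f (-G g) p ⟩
      coeff f p + coeff (-G g) p     ≈⟨ +-cong (f≈g p) (coeff-neg g p) ⟩
      coeff g p - coeff g p          ≈⟨ -‿inverseʳ (coeff g p) ⟩
      0#                             ∎

  +G-cong : ∀ {f f′ g g′} → f ≈G f′ → g ≈G g′ → (f +G g) ≈G (f′ +G g′)
  +G-cong {f} {f′} {g} {g′} f≈ g≈ p =
    trans (coeff-+ f g p) (trans (+-cong (f≈ p) (g≈ p)) (sym (coeff-+ f′ g′ p)))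

  +G-assoc : ∀ f g h → ((f +G g) +G h) ≈G (f +G (g +G h))
  +G-assoc f g h p = reflexive (≡.cong (λ l → coeff l p) (++-assoc f g h))

  +G-identityʳ : ∀ f → (f +G 0G) ≈G f
  +G-identityʳ f p = reflexive (≡.cong (λ l → coeff l p) (++-identityʳ f))

  +G-comm : ∀ f g → (f +G g) ≈G (g +G f)
  +G-comm f g p = trans (coeff-+ f g p) (trans (+-comm _ _) (sym (coeff-+ g f p)))

  -G-inverseʳ : ∀ f → (f +G (-G f)) ≈G 0G
  -G-inverseʳ f p = trans (coeff-+ f (-G f) p) (trans (+-congˡ (coeff-neg f p)) (-‿inverseʳ _))

  -G-cong : ∀ {f g} → f ≈G g → (-G f) ≈G (-G g)
  -G-cong {f} {g} f≈g p = trans (coeff-neg f p) (trans (-‿cong (f≈g p)) (sym (coeff-neg g p)))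

  *G-cong : ∀ {f f′ g g′} → f ≈G f′ → g ≈G g′ → (f *G g) ≈G (f′ *G g′)
  *G-cong {f} {f′} {g} {g′} f≈ g≈ = pairings⇒coeffs (f *G g) (f′ *G g′) λ F → begin
    ev (f *G g) F                               ≈⟨ ev-* f g F ⟩
    ev f (λ q → ev g (λ r → F (q ⊕ r)))         ≈⟨ coeffs⇒pairings f f′ f≈ _ ⟩
    ev f′ (λ q → ev g (λ r → F (q ⊕ r)))        ≈⟨ ev-cong f′ (λ q → coeffs⇒pairings g g′ g≈ _) ⟩
    ev f′ (λ q → ev g′ (λ r → F (q ⊕ r)))       ≈⟨ ev-* f′ g′ F ⟨
    ev (f′ *G g′) F                             ∎

  *G-assoc : ∀ f g h → ((f *G g) *G h) ≈G (f *G (g *G h))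
  *G-assoc f g h = pairings⇒coeffs ((f *G g) *G h) (f *G (g *G h)) λ F → begin
    ev ((f *G g) *G h) F                                         ≈⟨ ev-* (f *G g) h F ⟩
    ev (f *G g) (λ q → ev h (λ s → F (q ⊕ s)))                   ≈⟨ ev-* f g _ ⟩
    ev f (λ q → ev g (λ r → ev h (λ s → F ((q ⊕ r) ⊕ s))))       ≈⟨ ev-cong f (λ q → ev-cong g (λ r →
                                                                      ev-cong h (λ s → reflexive (≡.cong F (⊕-assoc q r s))))) ⟩
    ev f (λ q → ev g (λ r → ev h (λ s → F (q ⊕ (r ⊕ s)))))       ≈⟨ ev-cong f (λ q → ev-* g h _) ⟨
    ev f (λ q → ev (g *G h) (λ u → F (q ⊕ u)))                   ≈⟨ ev-* f (g *G h) F ⟨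
    ev (f *G (g *G h)) F                                         ∎

  *G-identityˡ : ∀ f → (1G *G f) ≈G f
  *G-identityˡ f = pairings⇒coeffs (1G *G f) f λ F → begin
    ev (1G *G f) F                         ≈⟨ ev-* 1G f F ⟩
    ev 1G (λ q → ev f (λ r → F (q ⊕ r)))   ≈⟨ ev-⟦⟧ origin (λ q → ev f (λ r → F (q ⊕ r))) ⟩
    ev f (λ r → F (origin ⊕ r))            ≈⟨ ev-cong f (λ r → reflexive (≡.cong F (⊕-identityˡ r))) ⟩
    ev f F                                 ∎

  *G-distribˡ : ∀ f g h → (f *G (g +G h)) ≈G ((f *G g) +G (f *G h))
  *G-distribˡ f g h = pairings⇒coeffs (f *G (g +G h)) ((f *G g) +G (f *G h)) λ F → begin
    ev (f *G (g +G h)) F                                   ≈⟨ ev-* f (g +G h) F ⟩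
    ev f (λ q → ev (g +G h) (λ r → F (q ⊕ r)))             ≈⟨ ev-cong f (λ q → ev-++ g h _) ⟩
    ev f (λ q → ev g (λ r → F (q ⊕ r)) + ev h (λ r → F (q ⊕ r)))
                                                           ≈⟨ ev-+F f _ _ ⟩
    ev f (λ q → ev g (λ r → F (q ⊕ r))) + ev f (λ q → ev h (λ r → F (q ⊕ r)))
                                                           ≈⟨ +-cong (ev-* f g F) (ev-* f h F) ⟨
    ev (f *G g) F + ev (f *G h) F                          ≈⟨ ev-++ (f *G g) (f *G h) F ⟨
    ev ((f *G g) +G (f *G h)) F                            ∎

  *G-comm : ∀ f g → (f *G g) ≈G (g *G f)
  *G-comm f g = pairings⇒coeffs (f *G g) (g *G f) λ F → begin
    ev (f *G g) F                              ≈⟨ ev-* f g F ⟩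
    ev f (λ q → ev g (λ r → F (q ⊕ r)))        ≈⟨ ev-swap f g _ ⟩
    ev g (λ r → ev f (λ q → F (q ⊕ r)))        ≈⟨ ev-cong g (λ r → ev-cong f (λ q → reflexive (≡.cong F (⊕-comm q r)))) ⟩
    ev g (λ r → ev f (λ q → F (r ⊕ q)))        ≈⟨ ev-* g f F ⟨
    ev (g *G f) F                              ∎

  ≈G-trans : ∀ {f g h} → f ≈G g → g ≈G h → f ≈G h
  ≈G-trans f≈g g≈h p = trans (f≈g p) (g≈h p)

  -G-inverseˡ : ∀ f → ((-G f) +G f) ≈G 0G
  -G-inverseˡ f = ≈G-trans {(-G f) +G f} {f +G (-G f)} {0G} (+G-comm (-G f) f) (-G-inverseʳ f)

  *G-identityʳ : ∀ f → (f *G 1G) ≈G f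
  *G-identityʳ f = ≈G-trans {f *G 1G} {1G *G f} {f} (*G-comm f 1G) (*G-identityˡ f)

  *G-distribʳ : ∀ f g h → ((g +G h) *G f) ≈G ((g *G f) +G (h *G f))
  *G-distribʳ f g h =
    ≈G-trans {(g +G h) *G f} {f *G (g +G h)} {(g *G f) +G (h *G f)} (*G-comm (g +G h) f)
      (≈G-trans {f *G (g +G h)} {(f *G g) +G (f *G h)} {(g *G f) +G (h *G f)} (*G-distribˡ f g h)
        (+G-cong {f *G g} {g *G f} {f *G h} {h *G f} (*G-comm f g) (*G-comm f h)))

  groupRing : CommutativeRing c ℓ
  groupRing = record
    { Carrier = KZ2 ; _≈_ = _≈G_ ; _+_ = _+G_ ; _*_ = _*G_ ; -_ = -G_ ; 0# = 0G ; 1# = 1G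
    ; isCommutativeRing = record
      { isRing = record
        { +-isAbelianGroup = record
          { isGroup = record
            { isMonoid = record
              { isSemigroup = record
                { isMagma = record
                  { isEquivalence = record { refl = λ p → refl ; sym = λ f≈g p → sym (f≈g p) ; trans = λ {f} {g} {h} → ≈G-trans {f} {g} {h} }
                  ; ∙-cong = λ {f} {f′} {g} {g′} → +G-cong {f} {f′} {g} {g′} }
                ; assoc = +G-assoc }
              ; identity = (λ f p → refl) , +G-identityʳ }
            ; inverse = -G-inverseˡ , -G-inverseʳ
            ; ⁻¹-cong = λ {f} {g} → -G-cong {f} {g} }
          ; comm = +G-comm }
        ; *-cong = λ {f} {f′} {g} {g′} → *G-cong {f} {f′} {g} {g′}
        ; *-assoc = *G-assoc
        ; *-identity = *G-identityˡ , *G-identityʳ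
        ; distrib = *G-distribˡ , *G-distribʳ }
      ; *-comm = *G-comm } }

-- A formal sum is divisible by [b] - 1 exactly
-- when all its line sums in direction b vanish; this turns divisibility into
-- a statement about finitely supported tables.
module LineSums {c ℓ} (k : CommutativeRing c ℓ) (b : Pt) (b≢0 : b ≢ origin) where
  open Plane
  open import Data.Integer as ℤ using (+_; -[1+_]; ∣_∣; _≤_; _<_; -≤+)
  import Data.Integer.Properties as ℤP
  open import Data.Nat as ℕ using (suc)
  import Data.Nat.Properties as ℕP
  open import Data.List using ([]; _∷_; length)
  open import Data.List.Properties using (length-map)
  open import Data.Empty using (⊥-elim)
  open import Relation.Binary.PropositionalEquality as ≡ using (_≡_)
  open import Relation.Nullary using (yes; no)

  open CommutativeRing k renaming (Carrier to K)
  open GroupRing k using (KZ2; coeff; _≈G_; _+G_; -G_; _*G_)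
  open Indicator k
  open Evaluation k
  open Multiples groupRing
  open Modulo (Δ b)
  open import Relation.Binary.Reasoning.Setoid setoid
  open import Algebra.Properties.Group +-group using (x∙y⁻¹≈ε⇒x≈y)

  χ : Pt → Pt → K
  χ y x = indicator (onLine? b b≢0 x y)

  lineSum : Pt → KZ2 → K
  lineSum y f = ev f (χ y)

  χ-self : ∀ y → χ y y ≡ 1#
  χ-self y = indicator-yes (onLine-refl b y) (onLine? b b≢0 y y)

  χ-periodic : ∀ y x → χ y (b ⊕ x) ≡ χ y x
  χ-periodic y x = indicator-cong
    (λ bx~y → onLine-trans (onLine-sym (onLine-step b x)) bx~y)
    (λ x~y → onLine-trans (onLine-step b x) x~y)
    (onLine? b b≢0 (b ⊕ x) y) (onLine? b b≢0 x y)

  χ-translate : ∀ a y x → χ (a ⊕ y) (a ⊕ x) ≡ χ y x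
  χ-translate a y x = indicator-cong (onLine-untranslate a) (onLine-translate a)
    (onLine? b b≢0 (a ⊕ x) (a ⊕ y)) (onLine? b b≢0 x y)

  -- Multiples of [b] - 1 have vanishing line sums, since χ y is b-periodic.
  multiple⇒lineSum≈0 : ∀ f → Multiple (Δ b) f → ∀ y → lineSum y f ≈ 0#
  multiple⇒lineSum≈0 f (u , f≈Δbu) y = begin
    lineSum y f                                  ≈⟨ coeffs⇒pairings f (Δ b *G u) f≈Δbu (χ y) ⟩
    ev (Δ b *G u) (χ y)                          ≈⟨ ev-Δ* b u (χ y) ⟩
    ev u (λ r → χ y (b ⊕ r)) - ev u (χ y)        ≈⟨ +-congʳ (ev-cong u (λ r → reflexive (χ-periodic y r))) ⟩
    ev u (χ y) - ev u (χ y)                      ≈⟨ -‿inverseʳ (ev u (χ y)) ⟩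
    0#                                           ∎

  congruent⇒lineSums : ∀ f g → Congruent (Δ b) f g → ∀ y → lineSum y f ≈ lineSum y g
  congruent⇒lineSums f g f≡g y = x∙y⁻¹≈ε⇒x≈y _ _ (begin
    lineSum y f - lineSum y g       ≈⟨ +-congˡ (ev-neg g (χ y)) ⟨
    lineSum y f + lineSum y (-G g)  ≈⟨ ev-++ f (-G g) (χ y) ⟨
    lineSum y (f +G (-G g))         ≈⟨ multiple⇒lineSum≈0 (f +G (-G g)) f≡g y ⟩
    0#                              ∎)

  lineSum-periodic : ∀ a h → Multiple (Δ b) (Δ a *G h) → ∀ y → lineSum (a ⊕ y) h ≈ lineSum y h
  lineSum-periodic a h mult y = sym (x∙y⁻¹≈ε⇒x≈y _ _ (begin
    lineSum y h - lineSum (a ⊕ y) h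
      ≈⟨ +-congʳ (ev-cong h (λ r → reflexive (≡.sym (χ-translate a y r)))) ⟩
    ev h (λ r → χ (a ⊕ y) (a ⊕ r)) - lineSum (a ⊕ y) h
      ≈⟨ ev-Δ* a h (χ (a ⊕ y)) ⟨
    lineSum (a ⊕ y) (Δ a *G h)
      ≈⟨ multiple⇒lineSum≈0 (Δ a *G h) mult (a ⊕ y) ⟩
    0# ∎))

  supportBound : KZ2 → ℕ
  supportBound []            = 0
  supportBound ((q , _) ∷ f) = ∣ cross b q ∣ ℕ.+ supportBound f

  far-lineSum≈0 : ∀ f z → + supportBound f < cross b z → lineSum z f ≈ 0#
  far-lineSum≈0 []            z _ = refl
  far-lineSum≈0 ((q , a) ∷ f) z beyond with onLine? b b≢0 q z
  ... | yes q~z = ⊥-elim (ℤP.<-irrefl ≡.refl (ℤP.≤-<-trans z-below beyond))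
    where
    i≤+∣i∣ : ∀ i → i ≤ + ∣ i ∣
    i≤+∣i∣ (+ n)    = ℤP.≤-refl
    i≤+∣i∣ -[1+ n ] = -≤+
    z-below : cross b z ≤ + (∣ cross b q ∣ ℕ.+ supportBound f)
    z-below = ℤP.≤-trans (ℤP.≤-reflexive (≡.sym (cross-onLine q~z)))
                (ℤP.≤-trans (i≤+∣i∣ (cross b q)) (ℤ.+≤+ (ℕP.m≤m+n _ _)))
  ... | no _ = trans (+-cong (zeroʳ a) (far-lineSum≈0 f z (ℤP.≤-<-trans (ℤ.+≤+ (ℕP.m≤n+m _ _)) beyond)))
                     (+-identityʳ 0#)

  -- If a is independent of b and [b] - 1 divides ([a] - 1)·h, then all line
  -- sums of h vanish: they are a-periodic, and translating by a suitable
  -- multiple of a moves any line beyond the support of h.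
  lineSums-vanish : ∀ a h → LinIndep a b → Multiple (Δ b) (Δ a *G h) → ∀ y → lineSum y h ≈ 0#
  lineSums-vanish a h indep mult y with
    progression-unbounded (cross b a) (cross b y) (supportBound h) (cross-indep a b indep)
  ... | m , beyond = begin
    lineSum y h                  ≈⟨ orbit-invariant setoid (λ z → lineSum z h) a (lineSum-periodic a h mult) m y ⟨
    lineSum ((m · a) ⊕ y) h      ≈⟨ far-lineSum≈0 h ((m · a) ⊕ y) (ℤP.<-≤-trans beyond (ℤP.≤-reflexive cross≡)) ⟩
    0#                           ∎
    where
    cross≡ : m ℤ.* cross b a ℤ.+ cross b y ≡ cross b ((m · a) ⊕ y)
    cross≡ = ≡.sym (≡.trans (cross-⊕ b (m · a) y) (≡.cong (ℤ._+ cross b y) (cross-· b m a)))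

  monomial-congruent : ∀ a p q → OnLine b p q → Congruent (Δ b) ((p , a) ∷ []) ((q , a) ∷ [])
  monomial-congruent a p q (n , p≡) =
    ≡.subst (λ p′ → Congruent (Δ b) ((p′ , a) ∷ []) ((q , a) ∷ [])) (≡.sym p≡)
      (orbit-invariant (congruence-setoid (Δ b)) (λ z → (z , a) ∷ []) b step n q)
    where
    step : ∀ y → Congruent (Δ b) ((b ⊕ y , a) ∷ []) ((y , a) ∷ [])
    step y = (y , a) ∷ [] , pairings⇒coeffs (((b ⊕ y , a) ∷ []) +G (-G ((y , a) ∷ []))) (Δ b *G ((y , a) ∷ [])) λ F → begin
      ev (((b ⊕ y , a) ∷ []) +G (-G ((y , a) ∷ []))) F
        ≈⟨ ev-++ ((b ⊕ y , a) ∷ []) (-G ((y , a) ∷ [])) F ⟩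
      ev ((b ⊕ y , a) ∷ []) F + ev (-G ((y , a) ∷ [])) F
        ≈⟨ +-congˡ (ev-neg ((y , a) ∷ []) F) ⟩
      ev ((y , a) ∷ []) (λ r → F (b ⊕ r)) - ev ((y , a) ∷ []) F
        ≈⟨ ev-Δ* b ((y , a) ∷ []) F ⟨
      ev (Δ b *G ((y , a) ∷ [])) F
        ∎

  push-congruent : ∀ π → (∀ p → OnLine b (π p) p) → ∀ f → Congruent (Δ b) (push π f) f
  push-congruent π along []            = congruent-reflexive {[]} {[]} (λ p → refl)
  push-congruent π along ((p , a) ∷ f) =
    congruent-+ {(π p , a) ∷ []} {(p , a) ∷ []} {push π f} {f}
      (monomial-congruent a (π p) p (along p)) (push-congruent π along f)

  collapse : Pt → Pt → Pt
  collapse q p with onLine? b b≢0 p q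
  ... | yes _ = q
  ... | no _  = p

  collapse-along : ∀ q p → OnLine b (collapse q p) p
  collapse-along q p with onLine? b b≢0 p q
  ... | yes p~q = onLine-sym p~q
  ... | no _    = onLine-refl b p

  δ-collapse : ∀ q p → δ q (collapse q p) ≡ χ q p
  δ-collapse q p with onLine? b b≢0 p q
  ... | yes _   = indicator-yes ≡.refl (q ≟ᵖ q)
  ... | no p≁q = indicator-no (λ p≡q → p≁q (≡.subst (λ x → OnLine b p x) p≡q (onLine-refl b p))) (p ≟ᵖ q)

  -- Conversely, a formal sum whose line sums all vanish is a multiple of
  -- [b] - 1: gather the line of its first point q at q; the coefficient
  -- there is a line sum, hence 0, so q can be dropped, and we recurse.
  lineSums⇒multiple : ∀ n h → length h ℕ.≤ n → (∀ y → lineSum y h ≈ 0#) → Multiple (Δ b) h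
  lineSums⇒multiple _       []            _           _       = multiple-0
  lineSums⇒multiple (suc n) h@((q , a) ∷ h′) (ℕ.s≤s ≤n) sums≈0 =
    congruent-multiple {h} {g} h≡g (multiple-resp {rest} {g} rest≈g
      (lineSums⇒multiple n rest shorter rest-sums≈0))
    where
    g : KZ2
    g = (q , a) ∷ push (collapse q) h′
    h≡g : Congruent (Δ b) h g
    h≡g = congruent-sym {g} {h} (congruent-+ {(q , a) ∷ []} {(q , a) ∷ []} {push (collapse q) h′} {h′}
            (congruent-reflexive {(q , a) ∷ []} {(q , a) ∷ []} (λ p → refl))
            (push-congruent (collapse q) (collapse-along q) h′))
    coeff-g≈0 : coeff g q ≈ 0#
    coeff-g≈0 = begin
      coeff g q                                       ≈⟨ coeff-here q a (push (collapse q) h′) ⟩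
      a + coeff (push (collapse q) h′) q              ≈⟨ +-congˡ (coeff-ev (push (collapse q) h′) q) ⟩
      a + ev (push (collapse q) h′) (δ q)             ≡⟨ ≡.cong (λ x → a + x) (ev-push (collapse q) h′ (δ q)) ⟩
      a + ev h′ (λ p → δ q (collapse q p))            ≈⟨ +-cong (sym (*-identityʳ a)) (ev-cong h′ (λ p → reflexive (δ-collapse q p))) ⟩
      a * 1# + lineSum q h′                           ≡⟨ ≡.cong (λ x → a * x + lineSum q h′) (≡.sym (χ-self q)) ⟩
      lineSum q h                                     ≈⟨ sums≈0 q ⟩
      0#                                              ∎
    rest : KZ2
    rest = remove q g
    rest≈g : rest ≈G g
    rest≈g = remove-vanishing q g coeff-g≈0
    shorter : length rest ℕ.≤ n
    shorter = ≡.subst (λ l → length l ℕ.≤ n) (≡.sym (remove-head q a (push (collapse q) h′)))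
                (ℕP.≤-trans (length-remove q (push (collapse q) h′))
                  (ℕP.≤-trans (ℕP.≤-reflexive (length-map _ h′)) ≤n))
    rest-sums≈0 : ∀ y → lineSum y rest ≈ 0#
    rest-sums≈0 y = begin
      lineSum y rest   ≈⟨ coeffs⇒pairings rest g rest≈g (χ y) ⟩
      lineSum y g      ≈⟨ congruent⇒lineSums h g h≡g y ⟨
      lineSum y h      ≈⟨ sums≈0 y ⟩
      0#               ∎

  cancellation : ∀ a → LinIndep a b → Cancellable (Δ b) (Δ a)
  cancellation a indep h mult =
    lineSums⇒multiple (length h) h ℕP.≤-refl (lineSums-vanish a h indep mult)

module Conductor {c ℓ} (k : CommutativeRing c ℓ) {t : ℕ} (d : Fin t → Pt)
  (d≢0 : ∀ i → d i ≢ origin) (indep : ∀ i j → i ≢ j → LinIndep (d i) (d j)) where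
  import Data.Fin.Properties as FinP
  open import Data.List using (List; filter; allFin)
  open import Data.List.Relation.Unary.All as All using ()
  open import Data.List.Membership.Propositional.Properties using (∈-filter⁺; ∈-filter⁻; ∈-allFin)
  import Data.List.Relation.Unary.Unique.Propositional.Properties as Unique
  open import Data.Product using (proj₁; proj₂)
  open import Data.Empty using (⊥-elim)
  open import Relation.Binary.PropositionalEquality as ≡ using (_≡_)
  open import Relation.Nullary using (yes; no; ¬?)

  open GroupRing k using (KZ2; _≈G_; _*G_; 0G; 1G; ModEq)
  open GroupRing.Lines k d
  open Evaluation k using (Δ; groupRing)
  open Multiples groupRing
  module R = CommutativeRing groupRing
  open import Algebra.Properties.CommutativeMonoid.Sum R.+-commutativeMonoid using (sum)

  -- Congruence modulo [d i] - 1 is exactly ModEq (d i).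
  module Mod (i : Fin t) = Modulo (Δ (d i))

  others : Fin t → List (Fin t)
  others i = filter (λ j → ¬? (j FinP.≟ i)) (allFin t)

  -- The factors [d j] - 1, indexed by direction; D i = product (map ι (others i)).
  ι : Fin t → KZ2
  ι j = Δ (d j)

  D-multiple : ∀ i j → i ≢ j → Multiple (Δ (d i)) (D j)
  D-multiple i j i≢j = factor-divides-product ι (∈-filter⁺ (λ j′ → ¬? (j′ FinP.≟ j)) (∈-allFin i) i≢j)

  coprime : ∀ i j → i ≢ j → Cancellable (Δ (d i)) (Δ (d j))
  coprime i j i≢j = LineSums.cancellation k (d i) (d≢0 i) (d j) (indep j i (λ j≡i → i≢j (≡.sym j≡i)))

  𝔣-isIdeal : IsIdeal 𝔣
  𝔣-isIdeal = record
    { respects = λ x y x≈y x∈𝔣 i → Mod.multipleMod-resp i (D i) {x i} {y i} (x≈y i) (x∈𝔣 i)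
    ; has-0    = λ i → Mod.multipleMod-0 i (D i)
    ; +-closed = λ x y x∈𝔣 y∈𝔣 i → Mod.multipleMod-+ i (D i) {x i} {y i} (x∈𝔣 i) (y∈𝔣 i)
    ; *-closed = λ x y x∈𝔣 i → Mod.multipleMod-*ˡ i (D i) (y i) {x i} (x∈𝔣 i)
    }

  -- 𝔣 ⊆ im σ: if xᵢ ≡ Dᵢ gᵢ for all i, then x = σ(Σⱼ Dⱼ gⱼ), because
  -- [d i] - 1 divides every Dⱼ with j ≠ i.
  𝔣⊆imσ : ∀ x → 𝔣 x → InImσ x
  𝔣⊆imσ x x∈𝔣 = f , λ i →
    Mod.congruent-trans i {x i} {term i} {f} (proj₂ (x∈𝔣 i)) (Mod.congruent-sym i {f} {term i} (f≡term i))
    where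
    g : Fin t → KZ2
    g j = proj₁ (x∈𝔣 j)
    term : Fin t → KZ2
    term j = D j *G g j
    f : KZ2
    f = sum term
    f≡term : ∀ i → Congruent (Δ (d i)) f (term i)
    f≡term i = Mod.sum-congruent-term i term i λ j j≢i →
      Mod.multiple-resp i {g j *G D j} {term j} (R.*-comm (g j) (D j))
        (Mod.multiple-*ˡ i (g j) {D j} (D-multiple i j (λ i≡j → j≢i (≡.sym i≡j))))

  unit : Fin t → L
  unit i j with j FinP.≟ i
  ... | yes _ = 1G
  ... | no _  = 0G

  unit-self : ∀ i → unit i i ≡ 1G
  unit-self i with i FinP.≟ i
  ... | yes _   = ≡.refl
  ... | no i≢i = ⊥-elim (i≢i ≡.refl)

  unit-other : ∀ i j → j ≢ i → unit i j ≡ 0G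
  unit-other i j j≢i with j FinP.≟ i
  ... | yes j≡i = ⊥-elim (j≢i j≡i)
  ... | no _    = ≡.refl

  -- Every ideal I ⊆ im σ lies in 𝔣: for x ∈ I, unit i · x ∈ I is σ f for some
  -- f with f ≡ xᵢ mod [d i] - 1 and f ≡ 0 mod [d j] - 1 for j ≠ i; by
  -- coprimality Dᵢ divides f.
  ideal⊆𝔣 : ∀ {p} (I : L → Set p) → IsIdeal I → (∀ x → I x → InImσ x) → ∀ x → I x → 𝔣 x
  ideal⊆𝔣 I isIdeal I⊆imσ x x∈I i = g , Mod.congruent-trans i {x i} {f} {D i *G g} xᵢ≡f
                                            (Mod.congruent-reflexive i {f} {D i *G g} f≈Dg)
    where
    image : InImσ (unit i *L x)
    image = I⊆imσ (unit i *L x) (IsIdeal.*-closed isIdeal x (unit i) x∈I)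
    f : KZ2
    f = proj₁ image
    xᵢ≡f : ModEq (d i) (x i) f
    xᵢ≡f = Mod.congruent-trans i {x i} {1G *G x i} {f}
             (Mod.congruent-reflexive i {x i} {1G *G x i} (R.sym {1G *G x i} {x i} (R.*-identityˡ (x i))))
             (≡.subst (λ u → ModEq (d i) (u *G x i) f) (unit-self i) (proj₂ image i))
    f-multiple : ∀ j → j ≢ i → Multiple (Δ (d j)) f
    f-multiple j j≢i = Mod.congruent-to-0 j {f}
      (≡.subst (λ u → ModEq (d j) (u *G x j) f) (unit-other i j j≢i) (proj₂ image j))
    D∣f : Multiple (D i) f
    D∣f = product-divides ι coprime {f} (others i)
            (Unique.filter⁺ (λ j → ¬? (j FinP.≟ i)) (Unique.allFin⁺ t))
            (All.tabulate λ {j} j∈others → f-multiple j (proj₂ (∈-filter⁻ (λ j → ¬? (j FinP.≟ i)) {xs = allFin t} j∈others)))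
    g : KZ2
    g = proj₁ D∣f
    f≈Dg : f ≈G (D i *G g)
    f≈Dg = proj₂ D∣f

mainTheorem5 : ∀ {c ℓ p : Level} (k : CommutativeRing c ℓ)
    → ¬ (CommutativeRing._≈_ k (CommutativeRing.1# k) (CommutativeRing.0# k))
    → (t : ℕ) (d : Fin t → Pt)
    → (∀ i → d i ≢ origin)
    → (∀ i j → i ≢ j → LinIndep (d i) (d j))
    → GroupRing.Lines.IsIdeal k d (GroupRing.Lines.𝔣 k d)
      × (∀ x → GroupRing.Lines.𝔣 k d x → GroupRing.Lines.InImσ k d x)
      × ((I : GroupRing.Lines.L k d → Set p)
          → GroupRing.Lines.IsIdeal k d I
          → (∀ x → I x → GroupRing.Lines.InImσ k d x)
          → ∀ x → I x → GroupRing.Lines.𝔣 k d x)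
mainTheorem5 k _ t d d≢0 indep = 𝔣-isIdeal , 𝔣⊆imσ , ideal⊆𝔣
  where open Conductor k d d≢0 indep
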